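{- Let $X$ be a matching on $[2n]$ with no left-nestings. Number the $n$ arcs of $X$ as $1,\dots,n$ from left to right according to their right endpoints, and let $\phi(X)=a_1a_2\ldots a_n$, where $a_i$ is the number of right endpoints (of arcs of $X$) lying to the left of the left endpoint of the $i$-th arc. Then $\phi$, restricted to matchings on $[2n]$ with no $2$-nestings, is a bijection onto the set of inversion tables $a_1a_2\ldots a_n$ (sequences of integers with $0\le a_i\le i-1$ for all $i$) for which there are no indices $p<q$ and integer $j$ with $a_p=j+1$ and $a_q=j$.
   Context: A matching on $[2n]$ is a partition of $\{1,\dots,2n\}$ into $n$ pairs $(a,b)$ with $a<b$; $a$ is the left endpoint and $b$ the right endpoint of the arc $(a,b)$. A nesting in a matching $X$ is a pair of pairs $(a,b),(c,d)\in X$ with $a<c<d<b$. A left-nesting is a nesting with $c=a+1$. A $2$-nesting is a nesting with $c-a\le 2$ (in particular every left-nesting is a $2$-nesting, so matchings with no $2$-nestings have no left-nestings and $\phi$ is defined on them). -}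

module Defs where

open import Data.Nat as ℕ using (ℕ; suc; _+_; _*_)
open import Data.Fin using (Fin; toℕ; _<_; _<?_)
open import Data.List using (List; length; filter; map; lookup; allFin)
open import Data.Product using (Σ; _×_; ∃)
open import Relation.Nullary using (¬_)
open import Relation.Nullary.Decidable using (_×-dec_)
open import Relation.Binary.PropositionalEquality using (_≡_; _≢_)

-- A matching on [2n], encoded (0-indexed, points 0 … 2n-1) by its
-- fixed-point-free involution: partner i is the point matched with i.
record Matching (n : ℕ) : Set where
  field
    partner     : Fin (2 * n) → Fin (2 * n)
    involutive  : ∀ i → partner (partner i) ≡ i
    noFixpoint  : ∀ i → partner i ≢ i
open Matching public

IsArc : ∀ {n} → Matching n → Fin (2 * n) → Fin (2 * n) → Set
IsArc X a b = a < b × partner X a ≡ b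

IsNesting : ∀ {n} → Matching n → (a b c d : Fin (2 * n)) → Set
IsNesting X a b c d = IsArc X a b × IsArc X c d × a < c × c < d × d < b

IsTwoNesting : ∀ {n} → Matching n → (a b c d : Fin (2 * n)) → Set
IsTwoNesting X a b c d = IsNesting X a b c d × toℕ c ℕ.≤ 2 + toℕ a

NoTwoNesting : ∀ {n} → Matching n → Set
NoTwoNesting X = ∀ a b c d → ¬ IsTwoNesting X a b c d

rightEnds : ∀ {n} → Matching n → List (Fin (2 * n))
rightEnds X = filter (λ j → partner X j <? j) (allFin _)

φ : ∀ {n} → Matching n → List ℕ
φ X = map (λ j → length (filter (λ k → (k <? partner X j) ×-dec (partner X k <? k)) (allFin _)))
          (rightEnds X)

-- inversion table of length n: 0 ≤ aᵢ ≤ i - 1 (1-indexed), i.e. the entry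
-- at 0-based position i is ≤ i
InversionTable : ℕ → List ℕ → Set
InversionTable n a = length a ≡ n × (∀ (i : Fin (length a)) → lookup a i ℕ.≤ toℕ i)

AvoidsPattern : List ℕ → Set
AvoidsPattern a = ∀ (p q : Fin (length a)) → p < q → lookup a p ≢ suc (lookup a q)

module Submission where

-- Label the endpoints of a matching: the right endpoint of arc i (arcs are
-- numbered by their right endpoints) is `cls i`, its left endpoint `opn i`.
-- A table A defines an order ≺ on labels (EndpointOrder): right endpoints by
-- arc number, `opn i` right after the first A i right endpoints, and left
-- endpoints in the same slot by arc number.
--  * Into (TwoNestingFree): partners of consecutive left endpoints increase,
--    as there is no left-nesting; this bounds the entries of φ X and, since
--    a 2-nesting is forbidden too, excludes the pattern.
--  * Injective (Labelling, φ-injective): the labels of a 2-nesting-free X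
--    increase along [2n] in the order of φ X, and two strictly monotone
--    enumerations of one finite ordered set coincide (MonotoneMaps); so φ X
--    fixes every label, hence every partner (the point of opposite label).
--  * Onto (Construction): sorting the 2n labels of a pattern-avoiding table
--    (Sort) and joining opposite labels gives a 2-nesting-free matching
--    with that table.

open import Defs
open import Data.Nat using (ℕ)
open import Data.List using (List)
open import Data.Product using (Σ; _×_)
open import Relation.Binary.PropositionalEquality using (_≡_)

open import Data.Nat using (zero; suc; _+_; _*_; _∸_; z≤n; s≤s; s≤s⁻¹; z<s; s<s; _≤_; _<_)
open import Data.Nat.Properties hiding (_≟_)
open import Data.Fin as F using (Fin; toℕ; fromℕ<)
  renaming (_<_ to _<ᶠ_; _≤_ to _≤ᶠ_)
import Data.Fin.Properties as Fin
open import Data.List using ([]; _∷_; length; filter; map; lookup; allFin)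
open import Data.List.Properties using (length-filter; filter-notAll; filter-reject; filter-accept; filter-none; length-tabulate; length-map)
import Data.List.Relation.Unary.All as All
open import Data.List.Relation.Unary.All.Properties using (all-filter) renaming (filter⁺ to all-filter⁺)
import Data.List.Relation.Unary.Any as Any
open import Data.List.Relation.Unary.Any.Properties using (lookup-index)
open import Data.List.Relation.Unary.AllPairs using (AllPairs; []; _∷_)
import Data.List.Relation.Unary.AllPairs.Properties as AllPairs
open import Data.List.Membership.Propositional using (_∈_)
open import Data.List.Membership.Propositional.Properties using (∈-filter⁺; ∈-allFin; ∈-lookup)
open import Data.Product using (_,_; proj₁; proj₂; ∃)
open import Data.Sum using (_⊎_; inj₁; inj₂)
open import Data.Empty using (⊥)
open import Function using (_∘_)
open import Induction.WellFounded using (WfRec)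
import Induction.WellFounded as WF
import Data.Fin.Induction as FinInd
open import Relation.Nullary using (¬_; yes; no; contradiction)
open import Relation.Nullary.Decidable using (_×-dec_)
open import Relation.Unary using (Pred; Decidable; _⊆_)
open import Relation.Binary using (Rel; Transitive; Trichotomous; tri<; tri≈; tri>)
open import Relation.Binary.Consequences using (tri⇒asym; tri⇒irr; tri⇒dec<)
open import Relation.Binary.PropositionalEquality
  using (refl; sym; trans; cong; cong₂; subst; subst₂; _≢_; module ≡-Reasoning)

module Counting {a p q} {A : Set a} {P : Pred A p} {Q : Pred A q}
                (P? : Decidable P) (Q? : Decidable Q) where

  filter-absorb : P ⊆ Q → ∀ xs → filter P? (filter Q? xs) ≡ filter P? xs
  filter-absorb P⊆Q [] = refl
  filter-absorb P⊆Q (x ∷ xs) with Q? x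
  ... | no ¬qx = trans (filter-absorb P⊆Q xs) (sym (filter-reject P? (¬qx ∘ P⊆Q)))
  ... | yes _ with P? x
  ...   | yes _ = cong (x ∷_) (filter-absorb P⊆Q xs)
  ...   | no _  = filter-absorb P⊆Q xs

  count-mono : P ⊆ Q → ∀ xs → length (filter P? xs) ≤ length (filter Q? xs)
  count-mono P⊆Q xs = subst (λ ys → length ys ≤ _) (filter-absorb P⊆Q xs) (length-filter P? (filter Q? xs))

  count-strict : P ⊆ Q → ∀ {x xs} → x ∈ xs → Q x → ¬ P x →
                 length (filter P? xs) < length (filter Q? xs)
  count-strict P⊆Q {x} {xs} x∈xs qx ¬px =
    subst (λ ys → length ys < _) (filter-absorb P⊆Q xs)
      (filter-notAll P? (filter Q? xs) (Any.map (λ { refl → ¬px }) (∈-filter⁺ Q? x∈xs qx)))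

  count-split : (∀ x → P x ⊎ Q x) → (∀ {x} → P x → ¬ Q x) →
                ∀ xs → length (filter P? xs) + length (filter Q? xs) ≡ length xs
  count-split P∪Q P∩Q [] = refl
  count-split P∪Q P∩Q (x ∷ xs) with P? x | Q? x
  ... | yes px | yes qx = contradiction qx (P∩Q px)
  ... | yes _  | no _   = cong suc (count-split P∪Q P∩Q xs)
  ... | no _   | yes _  = trans (+-suc _ _) (cong suc (count-split P∪Q P∩Q xs))
  ... | no ¬px | no ¬qx with P∪Q x
  ...   | inj₁ px = contradiction px ¬px
  ...   | inj₂ qx = contradiction qx ¬qx

module Rank {N p} {P : Pred (Fin N) p} (P? : Decidable P) where

  before? : (m : Fin N) → Decidable (λ k → k <ᶠ m × P k)
  before? m k = (k F.<? m) ×-dec P? k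

  below : Fin N → ℕ
  below m = length (filter (before? m) (allFin N))

  members : List (Fin N)
  members = filter P? (allFin N)

  size : ℕ
  size = length members

  -- In a strictly increasing list, the i-th element satisfying P is preceded
  -- by exactly i such elements.  (The decision procedure B? is kept abstract
  -- so that case analysis on P? does not reach inside it.)
  private
    below-in : (B? : ∀ m → Decidable (λ k → k <ᶠ m × P k)) →
               ∀ xs → AllPairs _<ᶠ_ xs → (i : Fin (length (filter P? xs))) →
               length (filter (B? (lookup (filter P? xs) i)) xs) ≡ toℕ i
    below-in B? (y ∷ ys) (y<ys ∷ ys↑) i with P? y
    below-in B? (y ∷ ys) (y<ys ∷ ys↑) F.zero | yes _ =
      trans (cong length (filter-reject (B? y) (<-irrefl refl ∘ proj₁)))
            (cong length (filter-none (B? y) (All.map (λ y<x x<y → <-asym y<x (proj₁ x<y)) y<ys)))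
    below-in B? (y ∷ ys) (y<ys ∷ ys↑) (F.suc i) | yes py =
      trans (cong length (filter-accept (B? _) (y<m , py))) (cong suc (below-in B? ys ys↑ i))
      where y<m : y <ᶠ lookup (filter P? ys) i
            y<m = All.lookup (all-filter⁺ P? y<ys) (∈-lookup i)
    ... | no ¬py = trans (cong length (filter-reject (B? _) (¬py ∘ proj₂))) (below-in B? ys ys↑ i)

  below-member : ∀ i → below (lookup members i) ≡ toℕ i
  below-member = below-in before? (allFin N) (AllPairs.tabulate⁺-< (λ i<j → i<j))

  member-satisfies : ∀ i → P (lookup members i)
  member-satisfies i = All.lookup (all-filter P? (allFin N)) (∈-lookup i)

  member-index : ∀ {x} → P x → ∃ λ i → lookup members i ≡ x
  member-index px = Any.index x∈ , sym (lookup-index x∈)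
    where x∈ = ∈-filter⁺ P? (∈-allFin _) px

  below-mono : ∀ {m m'} → m ≤ᶠ m' → below m ≤ below m'
  below-mono {m} {m'} m≤m' =
    Counting.count-mono (before? m) (before? m') (λ (k<m , pk) → <-≤-trans k<m m≤m' , pk) (allFin N)

  below-strict : ∀ {m m'} → P m → m <ᶠ m' → below m < below m'
  below-strict {m} {m'} pm m<m' =
    Counting.count-strict (before? m) (before? m') (λ (k<m , pk) → <-trans k<m m<m' , pk)
      (∈-allFin m) (m<m' , pm) (<-irrefl refl ∘ proj₁)

  below<size : ∀ {m} → P m → below m < size
  below<size {m} pm = Counting.count-strict (before? m) P? proj₂ (∈-allFin m) pm (<-irrefl refl ∘ proj₁)

  below≤size : ∀ m → below m ≤ size
  below≤size m = Counting.count-mono (before? m) P? proj₂ (allFin N)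

  below-reflects : ∀ {m m'} → below m < below m' → m <ᶠ m'
  below-reflects lt = ≰⇒> (λ m'≤m → <⇒≱ lt (below-mono m'≤m))

  next-member : ∀ {u w} → below u < below w →
                ∃ λ r → P r × below r ≡ below u × u ≤ᶠ r × r <ᶠ w
  next-member {u} {w} lt = r , member-satisfies i , r-rank , u≤r , below-reflects (subst (_< below w) (sym r-rank) lt)
    where
      i : Fin size
      i = fromℕ< (<-≤-trans lt (below≤size w))
      r : Fin N
      r = lookup members i
      r-rank : below r ≡ below u
      r-rank = trans (below-member i) (Fin.toℕ-fromℕ< _)
      u≤r : u ≤ᶠ r
      u≤r = ≮⇒≥ (λ r<u → <-irrefl r-rank (below-strict (member-satisfies i) r<u))

count-injection : ∀ {N p q} {P : Pred (Fin N) p} {Q : Pred (Fin N) q}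
                  (P? : Decidable P) (Q? : Decidable Q) (h : Fin N → Fin N) →
                  (∀ {x y} → h x ≡ h y → x ≡ y) → (∀ {x} → P x → Q (h x)) →
                  Rank.size P? ≤ Rank.size Q?
count-injection P? Q? h h-inj P→Q = Fin.injective⇒≤ {f = image} image-injective
  where
    module RP = Rank P?
    module RQ = Rank Q?
    image : Fin RP.size → Fin RQ.size
    image i = proj₁ (RQ.member-index (P→Q (RP.member-satisfies i)))
    image-spec : ∀ i → lookup RQ.members (image i) ≡ h (lookup RP.members i)
    image-spec i = proj₂ (RQ.member-index (P→Q (RP.member-satisfies i)))
    image-injective : ∀ {i i'} → image i ≡ image i' → i ≡ i'
    image-injective {i} {i'} eq = Fin.toℕ-injective (begin
      toℕ i                        ≡⟨ sym (RP.below-member i) ⟩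
      RP.below (lookup RP.members i)  ≡⟨ cong RP.below (h-inj (trans (sym (image-spec i))
                                           (trans (cong (lookup RQ.members) eq) (image-spec i')))) ⟩
      RP.below (lookup RP.members i') ≡⟨ RP.below-member i' ⟩
      toℕ i'                       ∎)
      where open ≡-Reasoning

injective⇒surjective : ∀ {N} (f : Fin N → Fin N) → (∀ {x y} → f x ≡ f y → x ≡ y) →
                       ∀ m → ∃ λ t → f t ≡ m
injective⇒surjective {suc N} f f-inj m with Fin.any? (λ t → f t Fin.≟ m)
... | yes hit = hit
... | no miss = contradiction (Fin.injective⇒≤ {f = avoid-m} avoid-m-injective) 1+n≰n
  where
    -- f misses m, so it factors injectively through Fin N
    avoid-m : Fin (suc N) → Fin N
    avoid-m t = F.punchOut {i = m} {j = f t} (λ eq → miss (t , sym eq))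
    avoid-m-injective : ∀ {x y} → avoid-m x ≡ avoid-m y → x ≡ y
    avoid-m-injective {x} {y} eq =
      f-inj (Fin.punchOut-injective (λ e → miss (x , sym e)) (λ e → miss (y , sym e)) eq)

module MonotoneMaps {ℓ r} {L : Set ℓ} {_≺_ : Rel L r} (compare : Trichotomous _≡_ _≺_) where

  StrictlyMonotone : ∀ {N} → (Fin N → L) → Set r
  StrictlyMonotone g = ∀ {s t} → s <ᶠ t → g s ≺ g t

  _⊑_ : ∀ {N} → (Fin N → L) → (Fin N → L) → Set ℓ
  g ⊑ h = ∀ s → ∃ λ t → h t ≡ g s

  module _ {N} {g : Fin N → L} (g↑ : StrictlyMonotone g) where

    monotone-reflects : ∀ {s t} → g s ≺ g t → s <ᶠ t
    monotone-reflects {s} {t} gs≺gt with Fin.<-cmp s t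
    ... | tri< s<t _ _  = s<t
    ... | tri≈ _ refl _ = contradiction gs≺gt (tri⇒irr compare refl)
    ... | tri> _ _ t<s  = contradiction gs≺gt (tri⇒asym compare (g↑ t<s))

    monotone-injective : ∀ {s t} → g s ≡ g t → s ≡ t
    monotone-injective {s} {t} eq with Fin.<-cmp s t
    ... | tri< s<t _ _ = contradiction (g↑ s<t) (tri⇒irr compare eq)
    ... | tri≈ _ s≡t _ = s≡t
    ... | tri> _ _ t<s = contradiction (g↑ t<s) (tri⇒irr compare (sym eq))

  -- If g and h agree before s and every value of g is one of h, then g s is
  -- not below h s: the value g s = h t would force t < s, hence g t = h t = g s.
  private
    not-below : ∀ {N} {g h : Fin N → L} → StrictlyMonotone g → StrictlyMonotone h → g ⊑ h →
                ∀ s → WfRec _<ᶠ_ (λ r → g r ≡ h r) s → ¬ g s ≺ h s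
    not-below {g = g} {h} g↑ h↑ g⊑h s agree gs≺hs = <-irrefl (cong toℕ t≡s) t<s
      where
        t = proj₁ (g⊑h s)
        t<s : t <ᶠ s
        t<s = monotone-reflects h↑ (subst (_≺ h s) (sym (proj₂ (g⊑h s))) gs≺hs)
        t≡s : t ≡ s
        t≡s = monotone-injective g↑ (trans (agree t<s) (proj₂ (g⊑h s)))

  monotone-unique : ∀ {N} {g h : Fin N → L} → StrictlyMonotone g → StrictlyMonotone h →
                    g ⊑ h → h ⊑ g → ∀ s → g s ≡ h s
  monotone-unique {g = g} {h} g↑ h↑ g⊑h h⊑g = WF.All.wfRec FinInd.<-wellFounded _ (λ s → g s ≡ h s) step
    where
      step : ∀ s → WfRec _<ᶠ_ (λ r → g r ≡ h r) s → g s ≡ h s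
      step s agree with compare (g s) (h s)
      ... | tri< gs≺hs _ _ = contradiction gs≺hs (not-below g↑ h↑ g⊑h s agree)
      ... | tri≈ _ eq _    = eq
      ... | tri> _ _ hs≺gs = contradiction hs≺gs (not-below h↑ g↑ h⊑g s (λ r<s → sym (agree r<s)))

  -- Sorting: an injective enumeration e of a finite set can be rearranged
  -- into a strictly monotone one, by sending each element to its rank.
  module Sort (≺-trans : Transitive _≺_) {N} (e : Fin N → L) (e-inj : ∀ {s t} → e s ≡ e t → s ≡ t) where

    rank : Fin N → ℕ
    rank t = length (filter (λ s → tri⇒dec< compare (e s) (e t)) (allFin N))

    -- ranks are distinct and increase with the order, so they form a
    -- permutation of Fin N
    rank-mono : ∀ {s t} → e s ≺ e t → rank s < rank t
    rank-mono {s} {t} es≺et =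
      Counting.count-strict (λ u → tri⇒dec< compare (e u) (e s)) (λ u → tri⇒dec< compare (e u) (e t))
        (λ eu≺es → ≺-trans eu≺es es≺et) (∈-allFin s) es≺et (tri⇒irr compare refl)

    rank<N : ∀ t → rank t < N
    rank<N t = subst (rank t <_) (length-tabulate (λ i → i))
      (filter-notAll (λ s → tri⇒dec< compare (e s) (e t)) (allFin N)
        (Any.map (λ { refl → tri⇒irr compare refl }) (∈-allFin t)))

    position : Fin N → Fin N
    position t = fromℕ< (rank<N t)

    position-mono : ∀ {s t} → e s ≺ e t → position s <ᶠ position t
    position-mono es≺et = subst₂ _<_ (sym (Fin.toℕ-fromℕ< _)) (sym (Fin.toℕ-fromℕ< _)) (rank-mono es≺et)

    position-injective : ∀ {s t} → position s ≡ position t → s ≡ t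
    position-injective {s} {t} eq with compare (e s) (e t)
    ... | tri< es≺et _ _ = contradiction (cong toℕ eq) (<⇒≢ (position-mono es≺et))
    ... | tri≈ _ es≡et _ = e-inj es≡et
    ... | tri> _ _ et≺es = contradiction (cong toℕ (sym eq)) (<⇒≢ (position-mono et≺es))

    unrank : Fin N → Fin N
    unrank m = proj₁ (injective⇒surjective position position-injective m)

    position-unrank : ∀ m → position (unrank m) ≡ m
    position-unrank m = proj₂ (injective⇒surjective position position-injective m)

    sorted : Fin N → L
    sorted m = e (unrank m)

    sorted-monotone : StrictlyMonotone sorted
    sorted-monotone {m} {m'} m<m' with compare (sorted m) (sorted m')
    ... | tri< lt _ _ = lt
    ... | tri≈ _ eq _ = contradiction (cong toℕ (trans (sym (position-unrank m))
                          (trans (cong position (e-inj eq)) (position-unrank m')))) (<⇒≢ m<m')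
    ... | tri> _ _ gt = contradiction (subst₂ _<ᶠ_ (position-unrank m') (position-unrank m) (position-mono gt))
                          (<-asym m<m')

    sorted-position : ∀ t → sorted (position t) ≡ e t
    sorted-position t = cong e (position-injective (position-unrank (position t)))

-- A strictly increasing self-map of Fin n is the identity: it is injective,
-- hence onto, so it enumerates Fin n monotonically just like the identity.
monotone-endo-is-id : ∀ {n} (c : Fin n → Fin n) → (∀ {i j} → i <ᶠ j → c i <ᶠ c j) → ∀ i → c i ≡ i
monotone-endo-is-id c c↑ =
  monotone-unique c↑ (λ i<j → i<j) (λ i → c i , refl)
    (λ i → injective⇒surjective c (monotone-injective c↑) i)
  where open MonotoneMaps Fin.<-cmp

-- Tables as functions: entry k of a list of numbers, 0 past the end.
at : List ℕ → ℕ → ℕ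
at []       _       = 0
at (x ∷ xs) zero    = x
at (x ∷ xs) (suc k) = at xs k

lookup-at : ∀ xs (i : Fin (length xs)) → lookup xs i ≡ at xs (toℕ i)
lookup-at (x ∷ xs) F.zero    = refl
lookup-at (x ∷ xs) (F.suc i) = lookup-at xs i

at-map : ∀ {A : Set} (g : A → ℕ) xs (i : Fin (length xs)) → at (map g xs) (toℕ i) ≡ g (lookup xs i)
at-map g (x ∷ xs) F.zero    = refl
at-map g (x ∷ xs) (F.suc i) = at-map g xs i

at-ext : ∀ xs ys → length xs ≡ length ys → (∀ k → k < length xs → at xs k ≡ at ys k) → xs ≡ ys
at-ext [] [] _ _ = refl
at-ext (x ∷ xs) (y ∷ ys) len same =
  cong₂ _∷_ (same 0 z<s) (at-ext xs ys (suc-injective len) (λ k k< → same (suc k) (s<s k<)))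

predecessor : ∀ {N} (v : Fin N) → 0 < toℕ v → ∃ λ (w : Fin N) → toℕ v ≡ suc (toℕ w)
predecessor {suc N} (F.suc w) _ = F.inject₁ w , cong suc (sym (Fin.toℕ-inject₁ w))

successor : ∀ {N} {v w : Fin N} → v <ᶠ w → ∃ λ (y : Fin N) → toℕ y ≡ suc (toℕ v)
successor {v = v} {w} v<w = fromℕ< {m = suc (toℕ v)} (≤-<-trans v<w (Fin.toℕ<n w)) , Fin.toℕ-fromℕ< _

-- Endpoint labels: `opn i` and `cls i` are the left and the right endpoint
-- of arc number i (arcs are numbered 0, 1, … by their right endpoints).
data Label : Set where
  opn cls : ℕ → Label

index : Label → ℕ
index (opn i) = i
index (cls i) = i

opposite : Label → Label
opposite (opn i) = cls i
opposite (cls i) = opn i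

opposite-involutive : ∀ ℓ → opposite (opposite ℓ) ≡ ℓ
opposite-involutive (opn i) = refl
opposite-involutive (cls i) = refl

index-opposite : ∀ ℓ → index (opposite ℓ) ≡ index ℓ
index-opposite (opn i) = refl
index-opposite (cls i) = refl

opposite-≢ : ∀ ℓ → opposite ℓ ≢ ℓ
opposite-≢ (opn i) ()
opposite-≢ (cls i) ()

-- The order in which the endpoints of a 2-nesting-free matching appear,
-- read off from its table A (A i = number of right endpoints left of the
-- left endpoint of arc i): right endpoints come in the order of their arcs,
-- the left endpoint of arc i comes after exactly A i right endpoints, and
-- left endpoints between the same two right endpoints come in the order of
-- their arcs (otherwise two adjacent ones would nest).
module EndpointOrder (A : ℕ → ℕ) where

  infix 4 _≺_
  data _≺_ : Label → Label → Set where
    cls≺cls       : ∀ {i j} → i < j → cls i ≺ cls j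
    opn≺cls       : ∀ {i j} → A i ≤ j → opn i ≺ cls j
    cls≺opn       : ∀ {i j} → j < A i → cls j ≺ opn i
    opn≺opn-slot  : ∀ {i j} → A i < A j → opn i ≺ opn j
    opn≺opn-index : ∀ {i j} → A i ≡ A j → i < j → opn i ≺ opn j

  ≺-trans : Transitive _≺_
  ≺-trans (cls≺cls i<j)            (cls≺cls j<k)            = cls≺cls (<-trans i<j j<k)
  ≺-trans (cls≺cls i<j)            (cls≺opn j<Ak)           = cls≺opn (<-trans i<j j<Ak)
  ≺-trans (opn≺cls Ai≤j)           (cls≺cls j<k)            = opn≺cls (≤-trans Ai≤j (<⇒≤ j<k))
  ≺-trans (opn≺cls Ai≤j)           (cls≺opn j<Ak)           = opn≺opn-slot (≤-<-trans Ai≤j j<Ak)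
  ≺-trans (cls≺opn i<Aj)           (opn≺cls Aj≤k)           = cls≺cls (<-≤-trans i<Aj Aj≤k)
  ≺-trans (cls≺opn i<Aj)           (opn≺opn-slot Aj<Ak)     = cls≺opn (<-trans i<Aj Aj<Ak)
  ≺-trans (cls≺opn i<Aj)           (opn≺opn-index Aj≡Ak _)  = cls≺opn (<-≤-trans i<Aj (≤-reflexive Aj≡Ak))
  ≺-trans (opn≺opn-slot Ai<Aj)     (opn≺cls Aj≤k)           = opn≺cls (<⇒≤ (<-≤-trans Ai<Aj Aj≤k))
  ≺-trans (opn≺opn-slot Ai<Aj)     (opn≺opn-slot Aj<Ak)     = opn≺opn-slot (<-trans Ai<Aj Aj<Ak)
  ≺-trans (opn≺opn-slot Ai<Aj)     (opn≺opn-index Aj≡Ak _)  = opn≺opn-slot (<-≤-trans Ai<Aj (≤-reflexive Aj≡Ak))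
  ≺-trans (opn≺opn-index Ai≡Aj _)  (opn≺cls Aj≤k)           = opn≺cls (≤-trans (≤-reflexive Ai≡Aj) Aj≤k)
  ≺-trans (opn≺opn-index Ai≡Aj _)  (opn≺opn-slot Aj<Ak)     = opn≺opn-slot (≤-<-trans (≤-reflexive Ai≡Aj) Aj<Ak)
  ≺-trans (opn≺opn-index Ai≡Aj i<j) (opn≺opn-index Aj≡Ak j<k) =
    opn≺opn-index (trans Ai≡Aj Aj≡Ak) (<-trans i<j j<k)

  cls≺cls⁻¹ : ∀ {i j} → cls i ≺ cls j → i < j
  cls≺cls⁻¹ (cls≺cls i<j) = i<j

  opn≺opn⁻¹ : ∀ {i j} → opn i ≺ opn j → A i < A j ⊎ (A i ≡ A j × i < j)
  opn≺opn⁻¹ (opn≺opn-slot Ai<Aj)      = inj₁ Ai<Aj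
  opn≺opn⁻¹ (opn≺opn-index Ai≡Aj i<j) = inj₂ (Ai≡Aj , i<j)

  ≺-asym : ∀ {x y} → x ≺ y → ¬ y ≺ x
  ≺-asym (cls≺cls i<j)           (cls≺cls j<i)           = <-asym i<j j<i
  ≺-asym (opn≺cls Ai≤j)          (cls≺opn j<Ai)          = <⇒≱ j<Ai Ai≤j
  ≺-asym (cls≺opn j<Ai)          (opn≺cls Ai≤j)          = <⇒≱ j<Ai Ai≤j
  ≺-asym (opn≺opn-slot Ai<Aj)    (opn≺opn-slot Aj<Ai)    = <-asym Ai<Aj Aj<Ai
  ≺-asym (opn≺opn-slot Ai<Aj)    (opn≺opn-index Aj≡Ai _) = <-irrefl (sym Aj≡Ai) Ai<Aj
  ≺-asym (opn≺opn-index Ai≡Aj _) (opn≺opn-slot Aj<Ai)    = <-irrefl (sym Ai≡Aj) Aj<Ai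
  ≺-asym (opn≺opn-index _ i<j)   (opn≺opn-index _ j<i)   = <-asym i<j j<i

  private
    total : ∀ x y → x ≺ y ⊎ x ≡ y ⊎ y ≺ x
    total (cls i) (cls j) with <-cmp i j
    ... | tri< i<j _ _  = inj₁ (cls≺cls i<j)
    ... | tri≈ _ refl _ = inj₂ (inj₁ refl)
    ... | tri> _ _ j<i  = inj₂ (inj₂ (cls≺cls j<i))
    total (opn i) (cls j) with A i ≤? j
    ... | yes Ai≤j = inj₁ (opn≺cls Ai≤j)
    ... | no Ai≰j  = inj₂ (inj₂ (cls≺opn (≰⇒> Ai≰j)))
    total (cls j) (opn i) with A i ≤? j
    ... | yes Ai≤j = inj₂ (inj₂ (opn≺cls Ai≤j))
    ... | no Ai≰j  = inj₁ (cls≺opn (≰⇒> Ai≰j))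
    total (opn i) (opn j) with <-cmp (A i) (A j) | <-cmp i j
    ... | tri< Ai<Aj _ _ | _              = inj₁ (opn≺opn-slot Ai<Aj)
    ... | tri> _ _ Aj<Ai | _              = inj₂ (inj₂ (opn≺opn-slot Aj<Ai))
    ... | tri≈ _ Ai≡Aj _ | tri< i<j _ _   = inj₁ (opn≺opn-index Ai≡Aj i<j)
    ... | tri≈ _ _ _     | tri≈ _ refl _  = inj₂ (inj₁ refl)
    ... | tri≈ _ Ai≡Aj _ | tri> _ _ j<i   = inj₂ (inj₂ (opn≺opn-index (sym Ai≡Aj) j<i))

  compare : Trichotomous _≡_ _≺_
  compare x y with total x y
  ... | inj₁ x≺y        = tri< x≺y (λ { refl → ≺-asym x≺y x≺y }) (≺-asym x≺y)
  ... | inj₂ (inj₁ x≡y) = tri≈ (λ x≺y → ≺-asym x≺y (subst₂ _≺_ x≡y (sym x≡y) x≺y)) x≡y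
                               (λ y≺x → ≺-asym y≺x (subst₂ _≺_ (sym x≡y) x≡y y≺x))
  ... | inj₂ (inj₂ y≺x) = tri> (≺-asym y≺x) (λ { refl → ≺-asym y≺x y≺x }) y≺x

-- With P = Closer, `below j` counts the right
-- endpoints strictly left of j and `members` is rightEnds X, so that φ X is
-- by definition the list of `below (partner X c)` over the right endpoints c.
module Endpoints {n} (X : Matching n) where

  p : Fin (2 * n) → Fin (2 * n)
  p = partner X

  Closer Opener : Fin (2 * n) → Set
  Closer j = p j <ᶠ j
  Opener j = j <ᶠ p j

  closer? : Decidable Closer
  closer? j = p j F.<? j

  opener? : Decidable Opener
  opener? j = j F.<? p j

  open Rank closer? public

  p-injective : ∀ {x y} → p x ≡ p y → x ≡ y
  p-injective {x} {y} eq = trans (sym (involutive X x)) (trans (cong p eq) (involutive X y))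

  closer-or-opener : ∀ j → Closer j ⊎ Opener j
  closer-or-opener j with Fin.<-cmp (p j) j
  ... | tri< pj<j _ _ = inj₁ pj<j
  ... | tri≈ _ pj≡j _ = contradiction pj≡j (noFixpoint X j)
  ... | tri> _ _ j<pj = inj₂ j<pj

  closer⇒¬opener : ∀ {j} → Closer j → ¬ Opener j
  closer⇒¬opener = <-asym

  ¬closer⇒opener : ∀ {j} → ¬ Closer j → Opener j
  ¬closer⇒opener {j} ¬cl with closer-or-opener j
  ... | inj₁ cl = contradiction cl ¬cl
  ... | inj₂ op = op

  closer⇒partner-opener : ∀ {j} → Closer j → Opener (p j)
  closer⇒partner-opener {j} cl = subst (p j <ᶠ_) (sym (involutive X j)) cl

  opener⇒partner-closer : ∀ {j} → Opener j → Closer (p j)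
  opener⇒partner-closer {j} op = subst (_<ᶠ p j) (sym (involutive X j)) op

  -- The partner map is a bijection between openers and closers, and the
  -- two kinds together make up all 2n points: there are exactly n arcs.
  size≡n : size ≡ n
  size≡n = *-cancelˡ-≡ size n 2 (begin
    size + (size + 0)     ≡⟨ cong (size +_) (trans (+-identityʳ size) (sym #openers≡size)) ⟩
    size + #openers       ≡⟨ Counting.count-split closer? opener? closer-or-opener closer⇒¬opener (allFin (2 * n)) ⟩
    length (allFin (2 * n)) ≡⟨ length-tabulate (λ i → i) ⟩
    2 * n                 ∎)
    where
      open ≡-Reasoning
      #openers : ℕ
      #openers = Rank.size opener?
      #openers≡size : #openers ≡ size
      #openers≡size = ≤-antisym (count-injection opener? closer? p p-injective opener⇒partner-closer)
                                (count-injection closer? opener? p p-injective closer⇒partner-opener)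

  length-φ : length (φ X) ≡ n
  length-φ = trans (length-map (below ∘ p) members) size≡n

  φ-entry : ∀ i → at (φ X) (toℕ i) ≡ below (p (lookup members i))
  φ-entry = at-map (below ∘ p) members

  arc : Fin (length (φ X)) → Fin size
  arc i = fromℕ< (subst (toℕ i <_) (length-map (below ∘ p) members) (Fin.toℕ<n i))

  toℕ-arc : ∀ i → toℕ (arc i) ≡ toℕ i
  toℕ-arc i = Fin.toℕ-fromℕ< _

  φ-lookup : ∀ i → lookup (φ X) i ≡ below (p (lookup members (arc i)))
  φ-lookup i = trans (lookup-at (φ X) i) (trans (cong (at (φ X)) (sym (toℕ-arc i))) (φ-entry (arc i)))

  entry-of-opener : ∀ {j} → Opener j → at (φ X) (below (p j)) ≡ below j
  entry-of-opener {j} op = begin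
    at (φ X) (below (p j))               ≡⟨ cong (at (φ X) ∘ below) (sym c≡pj) ⟩
    at (φ X) (below (lookup members i))  ≡⟨ cong (at (φ X)) (below-member i) ⟩
    at (φ X) (toℕ i)                     ≡⟨ φ-entry i ⟩
    below (p (lookup members i))         ≡⟨ cong (below ∘ p) c≡pj ⟩
    below (p (p j))                      ≡⟨ cong below (involutive X j) ⟩
    below j                              ∎
    where
      open ≡-Reasoning
      i = proj₁ (member-index (opener⇒partner-closer op))
      c≡pj = proj₂ (member-index (opener⇒partner-closer op))

  no-closer-between : ∀ {u w z} → below u ≡ below w → u ≤ᶠ z → z <ᶠ w → ¬ Closer z
  no-closer-between eq u≤z z<w cl = <-irrefl eq (≤-<-trans (below-mono u≤z) (below-strict cl z<w))

  openers-up-to : ∀ {u v} → below u ≡ below v → Opener v → ∀ {z} → u ≤ᶠ z → z ≤ᶠ v → Opener z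
  openers-up-to eq op-v u≤z z≤v with m≤n⇒m<n∨m≡n z≤v
  ... | inj₁ z<v = ¬closer⇒opener (no-closer-between eq u≤z z<v)
  ... | inj₂ z≡v = subst Opener (Fin.toℕ-injective (sym z≡v)) op-v

module TwoNestingFree {n} (X : Matching n) (no2 : NoTwoNesting X) where

  open Endpoints X

  close-openers : ∀ {w v} → w <ᶠ v → toℕ v ≤ 2 + toℕ w → Opener w → Opener v → p w <ᶠ p v
  close-openers {w} {v} w<v v≤2+w op-w op-v with Fin.<-cmp (p w) (p v)
  ... | tri< pw<pv _ _ = pw<pv
  ... | tri≈ _ pw≡pv _ = contradiction (cong toℕ (p-injective pw≡pv)) (<⇒≢ w<v)
  ... | tri> _ _ pv<pw = contradiction (((op-w , refl) , (op-v , refl) , w<v , op-v , pv<pw) , v≤2+w)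
                                       (no2 w (p w) v (p v))

  private
    opener-run : ∀ d {u v} → toℕ v ≡ d + toℕ u → (∀ {z} → u ≤ᶠ z → z ≤ᶠ v → Opener z) → p u ≤ᶠ p v
    opener-run zero {u} {v} v≡u _ = ≤-reflexive (cong (toℕ ∘ p) (Fin.toℕ-injective (sym v≡u)))
    opener-run (suc d) {u} {v} v≡d+u openers =
      ≤-trans (opener-run d w≡d+u (λ u≤z z≤w → openers u≤z (≤-trans z≤w w≤v)))
              (<⇒≤ (close-openers (≤-reflexive (sym v≡w+1)) (≤-trans (≤-reflexive v≡w+1) (n≤1+n _))
                                   (openers u≤w w≤v) (openers (≤-trans u≤w w≤v) ≤-refl)))
      where
        w : Fin (2 * n)
        w = proj₁ (predecessor v (subst (0 <_) (sym v≡d+u) z<s))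
        v≡w+1 : toℕ v ≡ suc (toℕ w)
        v≡w+1 = proj₂ (predecessor v (subst (0 <_) (sym v≡d+u) z<s))
        w≡d+u : toℕ w ≡ d + toℕ u
        w≡d+u = suc-injective (trans (sym v≡w+1) v≡d+u)
        u≤w : u ≤ᶠ w
        u≤w = subst (toℕ u ≤_) (sym w≡d+u) (m≤n+m (toℕ u) d)
        w≤v : w ≤ᶠ v
        w≤v = subst (toℕ w ≤_) (sym v≡w+1) (n≤1+n _)

  openers-increase : ∀ {u v} → u ≤ᶠ v → (∀ {z} → u ≤ᶠ z → z ≤ᶠ v → Opener z) → p u ≤ᶠ p v
  openers-increase {u} {v} u≤v = opener-run (toℕ v ∸ toℕ u) (sym (m∸n+n≡m u≤v))

  same-rank-openers : ∀ {u v} → below u ≡ below v → u ≤ᶠ v → Opener v → p u ≤ᶠ p v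
  same-rank-openers eq u≤v op-v = openers-increase u≤v (openers-up-to eq op-v)

  -- Entry i of φ X is the rank of a point left of the i-th right endpoint.
  φ-inversion-table : InversionTable n (φ X)
  φ-inversion-table = length-φ , entry≤index
    where
      entry≤index : ∀ i → lookup (φ X) i ≤ toℕ i
      entry≤index i = begin
        lookup (φ X) i                         ≡⟨ φ-lookup i ⟩
        below (p (lookup members (arc i)))     ≤⟨ below-mono (<⇒≤ (member-satisfies (arc i))) ⟩
        below (lookup members (arc i))         ≡⟨ below-member (arc i) ⟩
        toℕ (arc i)                            ≡⟨ toℕ-arc i ⟩
        toℕ i                                  ∎
        where open ≤-Reasoning

  -- Partners of left endpoints increase across a single right endpoint r
  -- with neighbours x = r - 1 and y = r + 1: [u, x] and [y, v] are runs of
  -- left endpoints, and x, y are at distance 2, so p u ≤ p x < p y ≤ p v.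
  around-closer : ∀ {u x r y v} → u ≤ᶠ x → toℕ r ≡ suc (toℕ x) → toℕ y ≡ suc (toℕ r) → y ≤ᶠ v →
                  Closer r → below r ≡ below u → below v ≡ suc (below r) → Opener v → p u <ᶠ p v
  around-closer {u} {x} {r} {y} {v} u≤x r≡x+1 y≡r+1 y≤v cl-r r-rank v-rank op-v =
    ≤-<-trans (openers-increase u≤x openers-ux)
      (<-≤-trans (close-openers x<y y≤2+x (openers-ux u≤x ≤-refl) op-y) (same-rank-openers y-rank y≤v op-v))
    where
      x<r : x <ᶠ r
      x<r = ≤-reflexive (sym r≡x+1)
      r<y : r <ᶠ y
      r<y = ≤-reflexive (sym y≡r+1)
      x<y : x <ᶠ y
      x<y = <-trans x<r r<y
      y≤2+x : toℕ y ≤ 2 + toℕ x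
      y≤2+x = ≤-reflexive (trans y≡r+1 (cong suc r≡x+1))
      -- [u, x] holds no right endpoint, since u and r have the same rank
      openers-ux : ∀ {z} → u ≤ᶠ z → z ≤ᶠ x → Opener z
      openers-ux u≤z z≤x = ¬closer⇒opener (no-closer-between (sym r-rank) u≤z (≤-<-trans z≤x x<r))
      y-rank : below y ≡ below v
      y-rank = ≤-antisym (below-mono y≤v) (subst (_≤ below y) (sym v-rank) (below-strict cl-r r<y))
      op-y : Opener y
      op-y = openers-up-to y-rank op-v ≤-refl y≤v

  -- If the rank jumps by one from a left endpoint u to a left endpoint v,
  -- the single right endpoint in between lies strictly inside (u, v).
  across-one-closer : ∀ {u v} → Opener u → Opener v → below v ≡ suc (below u) → p u <ᶠ p v
  across-one-closer {u} {v} op-u op-v jump =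
    around-closer u≤x (proj₂ x-pred) (proj₂ y-succ) (subst (_≤ toℕ v) (sym (proj₂ y-succ)) r<v)
      cl-r r-rank (trans jump (cong suc (sym r-rank))) op-v
    where
      found = next-member {u} {v} (≤-reflexive (sym jump))
      r = proj₁ found
      cl-r : Closer r
      cl-r = proj₁ (proj₂ found)
      r-rank : below r ≡ below u
      r-rank = proj₁ (proj₂ (proj₂ found))
      u<r : u <ᶠ r
      u<r = ≤∧≢⇒< (proj₁ (proj₂ (proj₂ (proj₂ found))))
              (λ eq → closer⇒¬opener cl-r (subst Opener (Fin.toℕ-injective eq) op-u))
      r<v : r <ᶠ v
      r<v = proj₂ (proj₂ (proj₂ (proj₂ found)))
      x-pred = predecessor r (≤-<-trans z≤n u<r)
      y-succ = successor r<v
      u≤x : u ≤ᶠ proj₁ x-pred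
      u≤x = s≤s⁻¹ (subst (toℕ u <_) (proj₂ x-pred) u<r)

  no-jump : ∀ {c₁ c₂} → Closer c₁ → Closer c₂ → c₁ <ᶠ c₂ → below (p c₁) ≢ suc (below (p c₂))
  no-jump {c₁} {c₂} cl₁ cl₂ c₁<c₂ jump = <-asym c₁<c₂
    (subst₂ _<ᶠ_ (involutive X c₂) (involutive X c₁)
      (across-one-closer (closer⇒partner-opener cl₂) (closer⇒partner-opener cl₁) jump))

  -- Entries of φ X are indexed by the right endpoints in increasing order.
  φ-avoids : AvoidsPattern (φ X)
  φ-avoids P Q P<Q eq = no-jump (member-satisfies (arc P)) (member-satisfies (arc Q)) cP<cQ
                          (trans (sym (φ-lookup P)) (trans eq (cong suc (φ-lookup Q))))
    where
      cP<cQ : lookup members (arc P) <ᶠ lookup members (arc Q)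
      cP<cQ = below-reflects (subst₂ _<_ (sym (trans (below-member (arc P)) (toℕ-arc P)))
                                          (sym (trans (below-member (arc Q)) (toℕ-arc Q))) P<Q)

module Labelling {n} (X : Matching n) where

  open Endpoints X
  open EndpointOrder (at (φ X))

  label : Fin (2 * n) → Label
  label j with closer? j
  ... | yes _ = cls (below j)
  ... | no _  = opn (below (p j))

  label-closer : ∀ {j} → Closer j → label j ≡ cls (below j)
  label-closer {j} cl with closer? j
  ... | yes _  = refl
  ... | no ¬cl = contradiction cl ¬cl

  label-opener : ∀ {j} → Opener j → label j ≡ opn (below (p j))
  label-opener {j} op with closer? j
  ... | yes cl = contradiction op (closer⇒¬opener cl)
  ... | no _   = refl

  label-partner : ∀ j → label (p j) ≡ opposite (label j)
  label-partner j with closer-or-opener j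
  ... | inj₁ cl = trans (label-opener (closer⇒partner-opener cl))
                        (trans (cong (opn ∘ below) (involutive X j)) (cong opposite (sym (label-closer cl))))
  ... | inj₂ op = trans (label-closer (opener⇒partner-closer op)) (cong opposite (sym (label-opener op)))

  label-bounded : ∀ j → index (label j) < n
  label-bounded j with closer-or-opener j
  ... | inj₁ cl = subst (λ ℓ → index ℓ < n) (sym (label-closer cl)) (subst (below j <_) size≡n (below<size cl))
  ... | inj₂ op = subst (λ ℓ → index ℓ < n) (sym (label-opener op))
                    (subst (below (p j) <_) size≡n (below<size (opener⇒partner-closer op)))

  label-onto : ∀ ℓ → index ℓ < n → ∃ λ j → label j ≡ ℓ
  label-onto (cls i) i<n = lookup members k ,
    trans (label-closer (member-satisfies k)) (cong cls (trans (below-member k) (Fin.toℕ-fromℕ< _)))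
    where k = fromℕ< (subst (i <_) (sym size≡n) i<n)
  label-onto (opn i) i<n = p c , trans (label-partner c) (cong opposite c-label)
    where c = proj₁ (label-onto (cls i) i<n)
          c-label = proj₂ (label-onto (cls i) i<n)

  label-monotone : NoTwoNesting X → ∀ {j k} → j <ᶠ k → label j ≺ label k
  label-monotone no2 {j} {k} j<k with closer-or-opener j | closer-or-opener k
  ... | inj₁ cl-j | inj₁ cl-k = subst₂ _≺_ (sym (label-closer cl-j)) (sym (label-closer cl-k))
          (cls≺cls (below-strict cl-j j<k))
  ... | inj₁ cl-j | inj₂ op-k = subst₂ _≺_ (sym (label-closer cl-j)) (sym (label-opener op-k))
          (cls≺opn (subst (below j <_) (sym (entry-of-opener op-k)) (below-strict cl-j j<k)))
  ... | inj₂ op-j | inj₁ cl-k = subst₂ _≺_ (sym (label-opener op-j)) (sym (label-closer cl-k))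
          (opn≺cls (subst (_≤ below k) (sym (entry-of-opener op-j)) (below-mono (<⇒≤ j<k))))
  ... | inj₂ op-j | inj₂ op-k = subst₂ _≺_ (sym (label-opener op-j)) (sym (label-opener op-k)) openers
    where
      open TwoNestingFree X no2
      entries = λ {z} (op : Opener z) → sym (entry-of-opener op)
      openers : opn (below (p j)) ≺ opn (below (p k))
      openers with m≤n⇒m<n∨m≡n (below-mono (<⇒≤ j<k))
      ... | inj₁ lt = opn≺opn-slot (subst₂ _<_ (entries op-j) (entries op-k) lt)
      ... | inj₂ eq = opn≺opn-index (trans (sym (entries op-j)) (trans eq (entries op-k)))
                        (below-strict (opener⇒partner-closer op-j) pj<pk)
        where pj<pk : p j <ᶠ p k
              pj<pk = ≤∧≢⇒< (same-rank-openers eq (<⇒≤ j<k) op-k)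
                        (λ e → <⇒≢ j<k (cong toℕ (p-injective (Fin.toℕ-injective e))))

-- φ is injective on 2-nesting-free matchings: the labellings of X and Y are
-- strictly monotone enumerations of the same labels in the same order, so
-- they coincide; and the partner of a point is the point with the opposite label.
φ-injective : ∀ {n} (X Y : Matching n) → NoTwoNesting X → NoTwoNesting Y → φ X ≡ φ Y →
              ∀ i → partner X i ≡ partner Y i
φ-injective X Y no2-X no2-Y φX≡φY i = monotone-injective label-X↑ (begin
    LX.label (partner X i)    ≡⟨ LX.label-partner i ⟩
    opposite (LX.label i)     ≡⟨ cong opposite (same-labels i) ⟩
    opposite (LY.label i)     ≡⟨ sym (LY.label-partner i) ⟩
    LY.label (partner Y i)    ≡⟨ sym (same-labels (partner Y i)) ⟩
    LX.label (partner Y i)    ∎)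
  where
    open ≡-Reasoning
    module LX = Labelling X
    module LY = Labelling Y
    open EndpointOrder (at (φ X))
    open MonotoneMaps compare
    label-X↑ : StrictlyMonotone LX.label
    label-X↑ = LX.label-monotone no2-X
    label-Y↑ : StrictlyMonotone LY.label
    label-Y↑ = subst (λ ψ → ∀ {j k} → j <ᶠ k → EndpointOrder._≺_ (at ψ) (LY.label j) (LY.label k))
                     (sym φX≡φY) (LY.label-monotone no2-Y)
    same-labels : ∀ j → LX.label j ≡ LY.label j
    same-labels = monotone-unique label-X↑ label-Y↑
                    (λ j → LY.label-onto _ (LX.label-bounded j)) (λ j → LX.label-onto _ (LY.label-bounded j))

-- Every pattern-avoiding inversion table a of length n is φ of a
-- 2-nesting-free matching: list the 2n labels of arcs 0 … n-1 in the
-- endpoint order of a, and join the two endpoints of every arc.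
module Construction {n} (a : List ℕ) (table : InversionTable n a) (avoids : AvoidsPattern a) where

  A : ℕ → ℕ
  A = at a

  open EndpointOrder A
  open MonotoneMaps compare

  private
    entry : ∀ {i} → i < n → Fin (length a)
    entry i<n = fromℕ< (subst (_ <_) (sym (proj₁ table)) i<n)

    lookup-entry : ∀ {i} (i<n : i < n) → lookup a (entry i<n) ≡ A i
    lookup-entry i<n = trans (lookup-at a (entry i<n)) (cong A (Fin.toℕ-fromℕ< _))

  A-bound : ∀ {i} → i < n → A i ≤ i
  A-bound i<n = subst₂ _≤_ (lookup-entry i<n) (Fin.toℕ-fromℕ< _) (proj₂ table (entry i<n))

  A-avoids : ∀ {k i} → k < i → i < n → A k ≢ suc (A i)
  A-avoids k<i i<n eq =
    avoids (entry k<n) (entry i<n) (subst₂ _<_ (sym (Fin.toℕ-fromℕ< _)) (sym (Fin.toℕ-fromℕ< _)) k<i)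
      (trans (lookup-entry k<n) (trans eq (cong suc (sym (lookup-entry i<n)))))
    where k<n = <-trans k<i i<n

  private
    labelOf : Fin 2 × Fin n → Label
    labelOf (F.zero , i)       = opn (toℕ i)
    labelOf (F.suc F.zero , i) = cls (toℕ i)

    labelOf-injective : ∀ {c c'} → labelOf c ≡ labelOf c' → c ≡ c'
    labelOf-injective {F.zero , i}       {F.zero , i'}       eq =
      cong (F.zero ,_) (Fin.toℕ-injective (cong index eq))
    labelOf-injective {F.suc F.zero , i} {F.suc F.zero , i'} eq =
      cong (F.suc F.zero ,_) (Fin.toℕ-injective (cong index eq))
    labelOf-injective {F.zero , _}       {F.suc F.zero , _}  ()
    labelOf-injective {F.suc F.zero , _} {F.zero , _}        ()

    codeOf : (ℓ : Label) → index ℓ < n → Fin 2 × Fin n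
    codeOf (opn i) i<n = F.zero , fromℕ< i<n
    codeOf (cls i) i<n = F.suc F.zero , fromℕ< i<n

    labelOf-codeOf : ∀ ℓ (h : index ℓ < n) → labelOf (codeOf ℓ h) ≡ ℓ
    labelOf-codeOf (opn i) h = cong opn (Fin.toℕ-fromℕ< h)
    labelOf-codeOf (cls i) h = cong cls (Fin.toℕ-fromℕ< h)

  enum : Fin (2 * n) → Label
  enum t = labelOf (F.remQuot n t)

  enum-bounded : ∀ t → index (enum t) < n
  enum-bounded t with F.remQuot {2} n t
  ... | F.zero , i       = Fin.toℕ<n i
  ... | F.suc F.zero , i = Fin.toℕ<n i

  enum-injective : ∀ {t t'} → enum t ≡ enum t' → t ≡ t'
  enum-injective {t} {t'} eq = trans (sym (Fin.combine-remQuot {2} n t))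
    (trans (cong (λ c → F.combine (proj₁ c) (proj₂ c)) (labelOf-injective eq)) (Fin.combine-remQuot {2} n t'))

  code : (ℓ : Label) → index ℓ < n → Fin (2 * n)
  code ℓ h = F.combine (proj₁ (codeOf ℓ h)) (proj₂ (codeOf ℓ h))

  enum-code : ∀ ℓ (h : index ℓ < n) → enum (code ℓ h) ≡ ℓ
  enum-code ℓ h = trans (cong labelOf (Fin.remQuot-combine (proj₁ (codeOf ℓ h)) (proj₂ (codeOf ℓ h))))
                        (labelOf-codeOf ℓ h)

  open Sort ≺-trans enum enum-injective

  -- (kept opaque: only the properties below are used, and unfolding the
  -- sorting procedure would only slow down type checking)
  opaque
    lab : Fin (2 * n) → Label
    lab = sorted

    lab↑ : StrictlyMonotone lab
    lab↑ = sorted-monotone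

    lab-bounded : ∀ m → index (lab m) < n
    lab-bounded m = enum-bounded (unrank m)

    place : (ℓ : Label) → index ℓ < n → Fin (2 * n)
    place ℓ h = position (code ℓ h)

    lab-place : ∀ ℓ (h : index ℓ < n) → lab (place ℓ h) ≡ ℓ
    lab-place ℓ h = trans (sorted-position (code ℓ h)) (enum-code ℓ h)

  ordered : ∀ {m m' ℓ ℓ'} → lab m ≡ ℓ → lab m' ≡ ℓ' → ℓ ≺ ℓ' → m <ᶠ m'
  ordered e e' ℓ≺ℓ' = monotone-reflects lab↑ (subst₂ _≺_ (sym e) (sym e') ℓ≺ℓ')

  join : Fin (2 * n) → Fin (2 * n)
  join m = place (opposite (lab m)) (subst (_< n) (sym (index-opposite (lab m))) (lab-bounded m))

  lab-join : ∀ m → lab (join m) ≡ opposite (lab m)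
  lab-join m = lab-place _ _

  X : Matching n
  X = record
    { partner    = join
    ; involutive = λ m → monotone-injective lab↑
        (trans (lab-join (join m)) (trans (cong opposite (lab-join m)) (opposite-involutive (lab m))))
    ; noFixpoint = λ m eq → opposite-≢ (lab m) (trans (sym (lab-join m)) (cong lab eq))
    }

  open Endpoints X

  -- In X, the point labelled `cls j` is a right endpoint and the point
  -- labelled `opn i` a left endpoint, since opn i ≺ cls i (A i ≤ i).
  cls⇒closer : ∀ {m j} → lab m ≡ cls j → Closer m
  cls⇒closer {m} {j} e = ordered (trans (lab-join m) (cong opposite e)) e (opn≺cls (A-bound j<n))
    where j<n = subst (λ ℓ → index ℓ < n) e (lab-bounded m)

  opn⇒opener : ∀ {m i} → lab m ≡ opn i → Opener m
  opn⇒opener {m} {i} e = ordered e (trans (lab-join m) (cong opposite e)) (opn≺cls (A-bound i<n))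
    where i<n = subst (λ ℓ → index ℓ < n) e (lab-bounded m)

  opener⇒opn : ∀ {m} → Opener m → ∃ λ i → lab m ≡ opn i
  opener⇒opn {m} op = by-cases (lab m) refl
    where
      by-cases : ∀ ℓ → lab m ≡ ℓ → ∃ λ i → lab m ≡ opn i
      by-cases (opn i) e = i , e
      by-cases (cls j) e = contradiction op (closer⇒¬opener (cls⇒closer e))

  -- The right endpoint of arc j has rank j: the right endpoints of arcs
  -- 0 … n-1 appear in this order, so their ranks increase and stay below n.
  private
    closing : Fin n → Fin (2 * n)
    closing i = place (cls (toℕ i)) (Fin.toℕ<n i)

    closing-lab : ∀ i → lab (closing i) ≡ cls (toℕ i)
    closing-lab i = lab-place _ _

    closing-rank : Fin n → Fin n
    closing-rank i = fromℕ< (subst (below (closing i) <_) size≡n (below<size (cls⇒closer (closing-lab i))))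

    closing-rank-id : ∀ i → closing-rank i ≡ i
    closing-rank-id = monotone-endo-is-id closing-rank λ {i} {i'} i<i' →
      subst₂ _<_ (sym (Fin.toℕ-fromℕ< _)) (sym (Fin.toℕ-fromℕ< _))
        (below-strict (cls⇒closer (closing-lab i)) (ordered (closing-lab i) (closing-lab i') (cls≺cls i<i')))

  rank-cls : ∀ {m j} → lab m ≡ cls j → below m ≡ j
  rank-cls {m} {j} e = begin
    below m                  ≡⟨ cong below (monotone-injective lab↑ (trans e (sym (trans (closing-lab i)
                                  (cong cls (Fin.toℕ-fromℕ< _)))))) ⟩
    below (closing i)        ≡⟨ sym (Fin.toℕ-fromℕ< _) ⟩
    toℕ (closing-rank i)     ≡⟨ cong toℕ (closing-rank-id i) ⟩
    toℕ i                    ≡⟨ Fin.toℕ-fromℕ< _ ⟩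
    j                        ∎
    where
      open ≡-Reasoning
      i = fromℕ< (subst (λ ℓ → index ℓ < n) e (lab-bounded m))

  -- The left endpoint of arc i has rank A i: it comes after the right
  -- endpoints of arcs 0 … A i - 1 and before that of arc A i.
  rank-opn : ∀ {m i} → lab m ≡ opn i → below m ≡ A i
  rank-opn {m} {i} e = ≤-antisym at-most (at-least (A i) ≤-refl)
    where
      i<n = subst (λ ℓ → index ℓ < n) e (lab-bounded m)
      Ai<n = ≤-<-trans (A-bound i<n) i<n
      at-most : below m ≤ A i
      at-most = subst (below m ≤_) (rank-cls (lab-place (cls (A i)) Ai<n))
                  (below-mono (<⇒≤ (ordered e (lab-place (cls (A i)) Ai<n) (opn≺cls ≤-refl))))
      at-least : ∀ k → k ≤ A i → k ≤ below m
      at-least zero    _    = z≤n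
      at-least (suc r) r<Ai = subst (_< below m) (rank-cls (lab-place (cls r) r<n))
                                (below-strict (cls⇒closer (lab-place (cls r) r<n))
                                  (ordered (lab-place (cls r) r<n) e (cls≺opn r<Ai)))
        where r<n = <-trans r<Ai Ai<n

  φ-table : φ X ≡ a
  φ-table = at-ext (φ X) a (trans length-φ (sym (proj₁ table))) entries
    where
      entries : ∀ k → k < length (φ X) → at (φ X) k ≡ A k
      entries k k<len = begin
        at (φ X) k               ≡⟨ cong (at (φ X)) (sym partner-rank) ⟩
        at (φ X) (below (p o))   ≡⟨ entry-of-opener (opn⇒opener o-lab) ⟩
        below o                  ≡⟨ rank-opn o-lab ⟩
        A k                      ∎
        where
          open ≡-Reasoning
          k<n = subst (k <_) length-φ k<len
          o = place (opn k) k<n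
          o-lab = lab-place (opn k) k<n
          partner-rank : below (p o) ≡ k
          partner-rank = rank-cls (trans (lab-join o) (cong opposite o-lab))


  -- If A i + 1 < A k, the right endpoints of arcs A i and A i + 1 lie
  -- between the left endpoints of arcs i and k, which are thus 3 apart.
  far-apart : ∀ {o₁ o₂ i k} → lab o₁ ≡ opn i → lab o₂ ≡ opn k → k < n → suc (A i) < A k →
              2 + toℕ o₁ < toℕ o₂
  far-apart {o₁} {o₂} {i} {k} lab-o₁ lab-o₂ k<n gap =
    ≤-trans (s≤s (s≤s o₁<q₁)) (≤-trans (s≤s q₁<q₂) q₂<o₂)
    where
      Ai+1<n = <-≤-trans gap (≤-trans (A-bound k<n) (<⇒≤ k<n))
      Ai<n   = <-trans (n<1+n (A i)) Ai+1<n
      q₁ = place (cls (A i)) Ai<n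
      q₂ = place (cls (suc (A i))) Ai+1<n
      o₁<q₁ : o₁ <ᶠ q₁
      o₁<q₁ = ordered lab-o₁ (lab-place _ Ai<n) (opn≺cls ≤-refl)
      q₁<q₂ : q₁ <ᶠ q₂
      q₁<q₂ = ordered (lab-place _ Ai<n) (lab-place _ Ai+1<n) (cls≺cls (n<1+n (A i)))
      q₂<o₂ : q₂ <ᶠ o₂
      q₂<o₂ = ordered (lab-place _ Ai+1<n) lab-o₂ (cls≺opn gap)

  -- A 2-nesting (o₁, c₁) ⊃ (o₂, c₂) would join arcs k < i with A i < A k:
  -- A k = A i + 1 is the forbidden pattern, and A k > A i + 1 is far-apart.
  no-2-nesting : NoTwoNesting X
  no-2-nesting o₁ c₁ o₂ c₂ (((o₁<c₁ , po₁≡c₁) , (o₂<c₂ , po₂≡c₂) , o₁<o₂ , _ , c₂<c₁) , o₂≤2+o₁) =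
    by-entries (opn≺opn⁻¹ (subst₂ _≺_ lab-o₁ lab-o₂ (lab↑ o₁<o₂)))
    where
      i = proj₁ (opener⇒opn (subst (o₁ <ᶠ_) (sym po₁≡c₁) o₁<c₁))
      lab-o₁ = proj₂ (opener⇒opn (subst (o₁ <ᶠ_) (sym po₁≡c₁) o₁<c₁))
      k = proj₁ (opener⇒opn (subst (o₂ <ᶠ_) (sym po₂≡c₂) o₂<c₂))
      lab-o₂ = proj₂ (opener⇒opn (subst (o₂ <ᶠ_) (sym po₂≡c₂) o₂<c₂))
      lab-c₁ : lab c₁ ≡ cls i
      lab-c₁ = trans (cong lab (sym po₁≡c₁)) (trans (lab-join o₁) (cong opposite lab-o₁))
      lab-c₂ : lab c₂ ≡ cls k
      lab-c₂ = trans (cong lab (sym po₂≡c₂)) (trans (lab-join o₂) (cong opposite lab-o₂))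
      k<i : k < i
      k<i = cls≺cls⁻¹ (subst₂ _≺_ lab-c₂ lab-c₁ (lab↑ c₂<c₁))
      i<n : i < n
      i<n = subst (λ ℓ → index ℓ < n) lab-o₁ (lab-bounded o₁)
      by-entries : A i < A k ⊎ (A i ≡ A k × i < k) → ⊥
      by-entries (inj₂ (_ , i<k)) = <-asym i<k k<i
      by-entries (inj₁ Ai<Ak) with m≤n⇒m<n∨m≡n Ai<Ak
      ... | inj₂ jump = A-avoids k<i i<n (sym jump)
      ... | inj₁ gap  = <⇒≱ (far-apart lab-o₁ lab-o₂ (<-trans k<i i<n) gap) o₂≤2+o₁

mainTheorem1 : ∀ (n : ℕ) →
    (∀ (X : Matching n) → NoTwoNesting X → InversionTable n (φ X) × AvoidsPattern (φ X))
    × (∀ (X Y : Matching n) → NoTwoNesting X → NoTwoNesting Y → φ X ≡ φ Y →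
         ∀ i → partner X i ≡ partner Y i)
    × (∀ (a : List ℕ) → InversionTable n a → AvoidsPattern a →
         Σ (Matching n) (λ X → NoTwoNesting X × φ X ≡ a))
mainTheorem1 n = into , φ-injective , onto
  where
    into : ∀ (X : Matching n) → NoTwoNesting X → InversionTable n (φ X) × AvoidsPattern (φ X)
    into X no2 = φ-inversion-table , φ-avoids
      where open TwoNestingFree X no2
    onto : ∀ (a : List ℕ) → InversionTable n a → AvoidsPattern a →
           Σ (Matching n) (λ X → NoTwoNesting X × φ X ≡ a)
    onto a table avoids = X , no-2-nesting , φ-table
      where open Construction a table avoids
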